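{- Let $n\equiv 5\pmod 8$ and write $n=4\ell+1$ (so $\ell$ is odd). Take the vertex set of the complete graph $K_{4\ell}$ to be $\{x_i : i\in\mathbb{Z}_{2\ell}\}\cup\{y_i : i\in\mathbb{Z}_{2\ell}\}$, and let $L=\{1,2,\ldots,\ell\}$. Then there do not exist 1-factors $F_1$ and $F_2$ of $K_{4\ell}$ such that (i) for each $d\in L$, $E(F_1)\cup E(F_2)$ contains exactly one edge of left pure length $d$ and exactly one edge of right pure length $d$, and for each $d\in\mathbb{Z}_{2\ell}$, $E(F_1)\cup E(F_2)$ contains exactly one edge of mixed difference $d$; and (ii) each of $F_1$ and $F_2$ contains exactly one edge of pure length $\ell$ (left or right).
   Context: For $i\in\mathbb{Z}_{2\ell}$ and $d\in L=\{1,\ldots,\ell\}$, an edge $x_ix_{i+d}$ (resp. $y_iy_{i+d}$) is called an edge of left (resp. right) pure length $d$; an edge $x_iy_{i+d}$ with $i,d\in\mathbb{Z}_{2\ell}$ is called an edge of mixed difference $d$. -}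

module Defs where

open import Data.Nat using (ℕ; _+_; _*_; _≤_)
open import Data.Nat.DivMod using (_%_)
open import Data.Fin using (Fin; toℕ)
open import Data.Product using (Σ; _×_; _,_)
open import Data.Sum using (_⊎_)
open import Data.Empty using (⊥)
open import Relation.Binary.PropositionalEquality using (_≡_; _≢_)

data Vtx (ℓ : ℕ) : Set where
  x : Fin (2 * ℓ) → Vtx ℓ
  y : Fin (2 * ℓ) → Vtx ℓ

-- AddMod N i d j :  j = i + d  in ℤ_N  (for i, j < N and d < N).
AddMod : ℕ → ℕ → ℕ → ℕ → Set
AddMod N i d j = (i + d ≡ j) ⊎ (i + d ≡ j + N)

-- A 1-factor (perfect matching) of the complete graph on Vtx ℓ, given by
-- its partner map: a fixed-point-free involution.  Its edge set is
-- { {v, partner v} : v vertex }.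
record OneFactor (ℓ : ℕ) : Set where
  field
    partner     : Vtx ℓ → Vtx ℓ
    involutive  : ∀ v → partner (partner v) ≡ v
    noFixpoint  : ∀ v → partner v ≢ v
open OneFactor public

InF : ∀ {ℓ} → OneFactor ℓ → Vtx ℓ → Vtx ℓ → Set
InF F u v = partner F u ≡ v

InUnion : ∀ {ℓ} → OneFactor ℓ → OneFactor ℓ → Vtx ℓ → Vtx ℓ → Set
InUnion F₁ F₂ u v = InF F₁ u v ⊎ InF F₂ u v

PureLenIdx : (ℓ : ℕ) → Fin (2 * ℓ) → Fin (2 * ℓ) → ℕ → Set
PureLenIdx ℓ i j d = AddMod (2 * ℓ) (toℕ i) d (toℕ j) ⊎ AddMod (2 * ℓ) (toℕ j) d (toℕ i)

LeftLen : ∀ {ℓ} → ℕ → Vtx ℓ → Vtx ℓ → Set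
LeftLen {ℓ} d (x i) (x j) = PureLenIdx ℓ i j d
LeftLen d _ _ = ⊥

RightLen : ∀ {ℓ} → ℕ → Vtx ℓ → Vtx ℓ → Set
RightLen {ℓ} d (y i) (y j) = PureLenIdx ℓ i j d
RightLen d _ _ = ⊥

PureLen : ∀ {ℓ} → ℕ → Vtx ℓ → Vtx ℓ → Set
PureLen d u v = LeftLen d u v ⊎ RightLen d u v

MixedDiff : ∀ {ℓ} → ℕ → Vtx ℓ → Vtx ℓ → Set
MixedDiff {ℓ} d (x i) (y j) = AddMod (2 * ℓ) (toℕ i) d (toℕ j)
MixedDiff {ℓ} d (y j) (x i) = AddMod (2 * ℓ) (toℕ i) d (toℕ j)
MixedDiff d _ _ = ⊥

-- There is exactly one (unordered) edge {u , v} with property P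
-- (P is applied to ordered pairs; uniqueness is up to swapping endpoints).
ExactlyOneEdge : ∀ {ℓ} → (Vtx ℓ → Vtx ℓ → Set) → Set
ExactlyOneEdge {ℓ} P =
  Σ (Vtx ℓ) λ u → Σ (Vtx ℓ) λ v → P u v ×
    (∀ u′ v′ → P u′ v′ → (u′ ≡ u × v′ ≡ v) ⊎ (u′ ≡ v × v′ ≡ u))

CondI : ∀ {ℓ} → OneFactor ℓ → OneFactor ℓ → Set
CondI {ℓ} F₁ F₂ =
  (∀ d → 1 ≤ d → d ≤ ℓ →
      ExactlyOneEdge (λ u v → InUnion F₁ F₂ u v × LeftLen d u v)
    × ExactlyOneEdge (λ u v → InUnion F₁ F₂ u v × RightLen d u v))
  × (∀ (d : Fin (2 * ℓ)) →
      ExactlyOneEdge (λ u v → InUnion F₁ F₂ u v × MixedDiff (toℕ d) u v))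

CondII : ∀ {ℓ} → OneFactor ℓ → OneFactor ℓ → Set
CondII {ℓ} F₁ F₂ =
    ExactlyOneEdge (λ u v → InF F₁ u v × PureLen ℓ u v)
  × ExactlyOneEdge (λ u v → InF F₂ u v × PureLen ℓ u v)

-- Call the ℓ left pure lengths, the ℓ right pure lengths and
-- the 2ℓ mixed differences the edge types.  Each edge of K_{4ℓ} has at most one type, so
-- sending each orientation of the type-c edge of E(F₁) ∪ E(F₂) to its tail and the factor
-- containing the edge is an injection from (types × 2) into (vertices × factors); as both
-- sets have 8ℓ elements it is a bijection.  Sum the parity of the vertex index mod 2 over
-- both sides.  Over (vertices × factors) every vertex occurs twice, so the sum is 0.  Since
-- 2ℓ is even, an edge of type c joins vertices whose parities add up to the parity of c, so
-- the sum over (types × 2) counts the types of odd length: (ℓ+1)/2 left, as many right, and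
-- ℓ mixed ones, i.e. ℓ mod 2.  Hence ℓ is even, whereas n ≡ 5 (mod 8) makes ℓ odd.
module Submission where

open import Defs
open import Algebra.Bundles using (CommutativeMonoid)
open import Algebra.Properties.CommutativeSemigroup using (interchange)
open import Data.Bool using (Bool; true; false; not)
open import Data.Fin as Fin using (Fin; zero; suc; toℕ; splitAt; punchOut)
open import Data.Fin.Permutation using (Permutation′; permutation)
open import Data.Fin.Properties using (+↔⊎; toℕ-injective; toℕ<n; any?; punchOut-injective; injective⇒≤)
open import Data.Nat using (ℕ; zero; suc; pred; _+_; _*_; _≤_; _<_; z≤n; s≤s; ⌊_/2⌋; parity)
open import Data.Nat.DivMod using (_%_; [m+kn]%n≡m%n)
open import Data.Nat.Properties
  using (+-identityʳ; +-assoc; +-suc; +-comm; +-cancelˡ-≡; +-mono-≤; +-mono-<; +-mono-<-≤;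
         ≤-refl; ≤-trans; ≤-antisym; ≤-<-trans; ≮⇒≥; <-irrefl; <⇒≢; <⇒≱;
         m≤n+m; m≤m+n; m<m+n; 1+n≰n; n≡⌊n+n/2⌋; +-commutativeSemigroup; module ≤-Reasoning)
open import Data.Nat.Tactic.RingSolver using (solve-∀)
open import Data.Parity.Base as ℙ using (Parity; 0ℙ; 1ℙ; _⁻¹)
open import Data.Parity.Properties using (+-homo-+; *-homo-*; p+p≡0ℙ; +-0-commutativeMonoid)
import Data.Parity.Properties as ℙₚ
open import Data.Product using (Σ; ∃; ∃₂; _×_; _,_; proj₁; proj₂)
open import Data.Sum using (_⊎_; inj₁; inj₂; [_,_]′)
import Data.Sum as Sum
open import Data.Sum.Function.Propositional using (_⊎-↔_)
open import Function using (_∘_; id)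
open import Function.Bundles using (_↔_; Inverse; Injection; mk↔ₛ′)
open import Function.Definitions using (Injective)
open import Function.Properties.Inverse using (↔-refl; ↔-sym; ↔-trans; ↔⇒↣)
open import Relation.Binary.PropositionalEquality
  using (_≡_; _≢_; refl; sym; trans; cong; cong₂; subst; subst₂; module ≡-Reasoning)
open import Relation.Nullary using (¬_; yes; no; contradiction)

injective⇒surjective : ∀ {n} {f : Fin n → Fin n} → Injective _≡_ _≡_ f → ∀ j → ∃ λ i → f i ≡ j
injective⇒surjective {zero}  _ ()
injective⇒surjective {suc n} {f} f-inj j with any? (λ i → f i Fin.≟ j)
... | yes hit  = hit
... | no  miss = contradiction (injective⇒≤ punchOut∘f-injective) 1+n≰n
  where
  j≢f : ∀ i → j ≢ f i
  j≢f i e = miss (i , sym e)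
  punchOut∘f-injective : Injective _≡_ _≡_ (λ i → punchOut (j≢f i))
  punchOut∘f-injective = f-inj ∘ punchOut-injective (j≢f _) (j≢f _)

injective⇒permutation : ∀ {n} {f : Fin n → Fin n} → Injective _≡_ _≡_ f → Permutation′ n
injective⇒permutation {f = f} f-inj =
  permutation f (proj₁ ∘ surj) (proj₂ ∘ surj) (λ i → f-inj (proj₂ (surj (f i))))
  where surj = injective⇒surjective f-inj

infixr 4 _⊎ₑ_

_⊎ₑ_ : ∀ {A B : Set} {m n} → A ↔ Fin m → B ↔ Fin n → (A ⊎ B) ↔ Fin (m + n)
eA ⊎ₑ eB = ↔-trans (eA ⊎-↔ eB) (↔-sym +↔⊎)

×Bool↔⊎ : ∀ {A : Set} → (A × Bool) ↔ (A ⊎ A)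
×Bool↔⊎ = mk↔ₛ′ (λ { (a , false) → inj₁ a ; (a , true) → inj₂ a }) [ (_, false) , (_, true) ]′
  (λ { (inj₁ _) → refl ; (inj₂ _) → refl }) (λ { (_ , false) → refl ; (_ , true) → refl })

×Boolₑ : ∀ {A : Set} {n} → A ↔ Fin n → (A × Bool) ↔ Fin (n + n)
×Boolₑ e = ↔-trans ×Bool↔⊎ (e ⊎ₑ e)

module EnumeratedSum {c r} (M : CommutativeMonoid c r) where

  open CommutativeMonoid M
    using (Carrier; _≈_; setoid)
    renaming (_∙_ to _+ₘ_; ∙-congˡ to +ₘ-congˡ; assoc to +ₘ-assoc; identityˡ to +ₘ-identityˡ;
              sym to ≈-sym; trans to ≈-trans)
  open import Algebra.Properties.CommutativeMonoid.Sum M public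
    using (sum; sum-permute; ∑-distrib-+; sum-cong-≗; sum-replicate-zero)
  open import Relation.Binary.Reasoning.Setoid setoid

  ∑ : ∀ {A : Set} {n} → A ↔ Fin n → (A → Carrier) → Carrier
  ∑ e f = sum (f ∘ Inverse.from e)

  ∑-cong : ∀ {A : Set} {n} (e : A ↔ Fin n) {f g : A → Carrier} → (∀ a → f a ≡ g a) → ∑ e f ≡ ∑ e g
  ∑-cong e f≗g = sum-cong-≗ (f≗g ∘ Inverse.from e)

  sum-splitAt : ∀ m {n} (g : Fin m ⊎ Fin n → Carrier) →
                sum (g ∘ splitAt m) ≈ sum (g ∘ inj₁) +ₘ sum (g ∘ inj₂)
  sum-splitAt zero    g = ≈-sym (+ₘ-identityˡ _)
  sum-splitAt (suc m) g = begin
    g (inj₁ zero) +ₘ sum (g ∘ Sum.map₁ suc ∘ splitAt m)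
      ≈⟨ +ₘ-congˡ (sum-splitAt m (g ∘ Sum.map₁ suc)) ⟩
    g (inj₁ zero) +ₘ (sum (g ∘ inj₁ ∘ suc) +ₘ sum (g ∘ inj₂))
      ≈⟨ +ₘ-assoc _ _ _ ⟨
    (g (inj₁ zero) +ₘ sum (g ∘ inj₁ ∘ suc)) +ₘ sum (g ∘ inj₂)
      ∎

  ∑-⊎ : ∀ {A B : Set} {m n} (eA : A ↔ Fin m) (eB : B ↔ Fin n) (f : A ⊎ B → Carrier) →
        ∑ (eA ⊎ₑ eB) f ≈ ∑ eA (f ∘ inj₁) +ₘ ∑ eB (f ∘ inj₂)
  ∑-⊎ {m = m} eA eB f = sum-splitAt m (f ∘ Sum.map (Inverse.from eA) (Inverse.from eB))

  ∑-×Bool : ∀ {A : Set} {n} (e : A ↔ Fin n) (f : A × Bool → Carrier) →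
            ∑ (×Boolₑ e) f ≈ ∑ e (λ a → f (a , false) +ₘ f (a , true))
  ∑-×Bool e f = ≈-trans (∑-⊎ e e (f ∘ Inverse.from ×Bool↔⊎))
    (≈-sym (∑-distrib-+ (λ i → f (Inverse.from e i , false)) (λ i → f (Inverse.from e i , true))))

  ∑-injection : ∀ {A B : Set} {m n} (eA : A ↔ Fin m) (eB : B ↔ Fin n) → m ≡ n →
                {g : A → B} → Injective _≡_ _≡_ g → (f : B → Carrier) → ∑ eA (f ∘ g) ≈ ∑ eB f
  ∑-injection eA eB refl {g} g-inj f = begin
    ∑ eA (f ∘ g)
      ≡⟨ sum-cong-≗ (cong f ∘ sym ∘ Inverse.strictlyInverseʳ eB ∘ g ∘ Inverse.from eA) ⟩
    sum (f ∘ Inverse.from eB ∘ Inverse.to π)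
      ≈⟨ sum-permute (f ∘ Inverse.from eB) π ⟨
    ∑ eB f
      ∎
    where
    π = injective⇒permutation {f = Inverse.to eB ∘ g ∘ Inverse.from eA}
          (Injection.injective (↔⇒↣ (↔-sym eA)) ∘ g-inj ∘ Injection.injective (↔⇒↣ eB))

open EnumeratedSum +-0-commutativeMonoid

+-exchange : ∀ i j {d d′} a b → i + d ≡ j + a → j + d′ ≡ i + b → d + d′ ≡ a + b
+-exchange i j {d} {d′} a b e e′ = +-cancelˡ-≡ (i + j) _ _ (begin
  (i + j) + (d + d′)  ≡⟨ interchange +-commutativeSemigroup i j d d′ ⟩
  (i + d) + (j + d′)  ≡⟨ cong₂ _+_ e e′ ⟩
  (j + a) + (i + b)   ≡⟨ interchange +-commutativeSemigroup j a i b ⟩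
  (j + i) + (a + b)   ≡⟨ cong (_+ (a + b)) (+-comm j i) ⟩
  (i + j) + (a + b)   ∎)
  where open ≡-Reasoning

AddMod-unique : ∀ {N i d d′ j} → d < N → d′ < N → AddMod N i d j → AddMod N i d′ j → d ≡ d′
AddMod-unique {i = i} _ _ (inj₁ e) (inj₁ e′) = +-cancelˡ-≡ i _ _ (trans e (sym e′))
AddMod-unique {i = i} _ _ (inj₂ e) (inj₂ e′) = +-cancelˡ-≡ i _ _ (trans e (sym e′))
AddMod-unique {N} {i} {d} _ d′<N (inj₁ e) (inj₂ e′) =
  contradiction (subst (N ≤_) (sym d′≡d+N) (m≤n+m N d)) (<⇒≱ d′<N)
  where d′≡d+N = +-cancelˡ-≡ i _ _ (trans e′ (trans (cong (_+ N) (sym e)) (+-assoc i d N)))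
AddMod-unique d<N d′<N (inj₂ e) (inj₁ e′) = sym (AddMod-unique d′<N d<N (inj₁ e′) (inj₂ e))

AddMod-opposite : ∀ {N i j d d′} → AddMod N i d j → AddMod N j d′ i →
                  d + d′ ≡ 0 ⊎ d + d′ ≡ N ⊎ d + d′ ≡ N + N
AddMod-opposite {N} {i} {j} (inj₁ e) (inj₁ e′) =
  inj₁ (+-exchange i j 0 0 (trans e (sym (+-identityʳ j))) (trans e′ (sym (+-identityʳ i))))
AddMod-opposite {N} {i} {j} (inj₁ e) (inj₂ e′) =
  inj₂ (inj₁ (+-exchange i j 0 N (trans e (sym (+-identityʳ j))) e′))
AddMod-opposite {N} {i} {j} (inj₂ e) (inj₁ e′) =
  inj₂ (inj₁ (trans (+-exchange i j N 0 e (trans e′ (sym (+-identityʳ i)))) (+-identityʳ N)))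
AddMod-opposite {N} {i} {j} (inj₂ e) (inj₂ e′) =
  inj₂ (inj₂ (+-exchange i j N N e e′))

m+n≡o+o⇒m≡o : ∀ {m n o} → m ≤ o → n ≤ o → m + n ≡ o + o → m ≡ o
m+n≡o+o⇒m≡o m≤o n≤o e = ≤-antisym m≤o (≮⇒≥ (λ m<o → <-irrefl e (+-mono-<-≤ m<o n≤o)))

2*n≡n+n : ∀ n → 2 * n ≡ n + n
2*n≡n+n n = cong (n +_) (+-identityʳ n)

m≤n⇒m<2*n : ∀ {m n} → 1 ≤ m → m ≤ n → m < 2 * n
m≤n⇒m<2*n {n = n} 1≤m m≤n =
  ≤-<-trans m≤n (m<m+n n (subst (1 ≤_) (sym (+-identityʳ n)) (≤-trans 1≤m m≤n)))

-- Opposite orientations force d + d′ ∈ {0, 2ℓ, 4ℓ}; within 2 ≤ d + d′ ≤ 2ℓ only d = d′ = ℓ remains.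
pureLength-opposite : ∀ {ℓ i j d d′} → 1 ≤ d → d ≤ ℓ → 1 ≤ d′ → d′ ≤ ℓ →
                      AddMod (2 * ℓ) i d j → AddMod (2 * ℓ) j d′ i → d ≡ d′
pureLength-opposite {ℓ} {d = d} {d′} 1≤d d≤ℓ 1≤d′ d′≤ℓ m m′ with AddMod-opposite m m′
... | inj₁ d+d′≡0 = contradiction (subst (1 ≤_) d+d′≡0 (≤-trans 1≤d (m≤m+n d d′))) λ ()
... | inj₂ (inj₁ d+d′≡2ℓ) =
  trans (m+n≡o+o⇒m≡o d≤ℓ d′≤ℓ d+d′≡ℓ+ℓ)
        (sym (m+n≡o+o⇒m≡o d′≤ℓ d≤ℓ (trans (+-comm d′ d) d+d′≡ℓ+ℓ)))
  where d+d′≡ℓ+ℓ = trans d+d′≡2ℓ (2*n≡n+n ℓ)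
... | inj₂ (inj₂ d+d′≡4ℓ) = contradiction d+d′≡4ℓ (<⇒≢ (begin-strict
  d + d′         ≤⟨ +-mono-≤ d≤ℓ d′≤ℓ ⟩
  ℓ + ℓ          <⟨ +-mono-< ℓ<2ℓ ℓ<2ℓ ⟩
  2 * ℓ + 2 * ℓ  ∎))
  where
  open ≤-Reasoning
  ℓ<2ℓ = m≤n⇒m<2*n (≤-trans 1≤d d≤ℓ) ≤-refl

pureLength-unique : ∀ {ℓ} {i j : Fin (2 * ℓ)} {d d′} → 1 ≤ d → d ≤ ℓ → 1 ≤ d′ → d′ ≤ ℓ →
                    PureLenIdx ℓ i j d → PureLenIdx ℓ i j d′ → d ≡ d′
pureLength-unique 1≤d d≤ℓ 1≤d′ d′≤ℓ (inj₁ m) (inj₁ m′) =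
  AddMod-unique (m≤n⇒m<2*n 1≤d d≤ℓ) (m≤n⇒m<2*n 1≤d′ d′≤ℓ) m m′
pureLength-unique 1≤d d≤ℓ 1≤d′ d′≤ℓ (inj₂ m) (inj₂ m′) =
  AddMod-unique (m≤n⇒m<2*n 1≤d d≤ℓ) (m≤n⇒m<2*n 1≤d′ d′≤ℓ) m m′
pureLength-unique 1≤d d≤ℓ 1≤d′ d′≤ℓ (inj₁ m) (inj₂ m′) = pureLength-opposite 1≤d d≤ℓ 1≤d′ d′≤ℓ m m′
pureLength-unique 1≤d d≤ℓ 1≤d′ d′≤ℓ (inj₂ m) (inj₁ m′) = pureLength-opposite 1≤d d≤ℓ 1≤d′ d′≤ℓ m m′

p+q≡r⇒p+r≡q : ∀ p q r → p ℙ.+ q ≡ r → p ℙ.+ r ≡ q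
p+q≡r⇒p+r≡q 0ℙ q  _ refl = refl
p+q≡r⇒p+r≡q 1ℙ 0ℙ _ refl = refl
p+q≡r⇒p+r≡q 1ℙ 1ℙ _ refl = refl

parity-2*n : ∀ n → parity (2 * n) ≡ 0ℙ
parity-2*n n = *-homo-* 2 n

AddMod-parity : ∀ {N i d j} → parity N ≡ 0ℙ → AddMod N i d j → parity i ℙ.+ parity j ≡ parity d
AddMod-parity {N} {i} {d} {j} N-even m =
  p+q≡r⇒p+r≡q (parity i) _ _ (trans (sym (+-homo-+ i d)) (parity-wrap m))
  where
  parity-wrap : AddMod N i d j → parity (i + d) ≡ parity j
  parity-wrap (inj₁ e) = cong parity e
  parity-wrap (inj₂ e) = begin
    parity (i + d)         ≡⟨ cong parity e ⟩
    parity (j + N)         ≡⟨ +-homo-+ j N ⟩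
    parity j ℙ.+ parity N  ≡⟨ cong (parity j ℙ.+_) N-even ⟩
    parity j ℙ.+ 0ℙ        ≡⟨ ℙₚ.+-identityʳ (parity j) ⟩
    parity j               ∎
    where open ≡-Reasoning

pureLength-parity : ∀ {ℓ} {i j : Fin (2 * ℓ)} {d} → PureLenIdx ℓ i j d →
                    parity (toℕ i) ℙ.+ parity (toℕ j) ≡ parity d
pureLength-parity {ℓ} {i} {j} {d} (inj₁ m) = AddMod-parity {i = toℕ i} {d} (parity-2*n ℓ) m
pureLength-parity {ℓ} {i} {j} {d} (inj₂ m) =
  trans (ℙₚ.+-comm (parity (toℕ i)) _) (AddMod-parity {i = toℕ j} {d} (parity-2*n ℓ) m)

∑-parity-toℕ : ∀ n → sum {n} (parity ∘ toℕ) ≡ parity ⌊ n /2⌋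
∑-parity-toℕ zero          = refl
∑-parity-toℕ (suc zero)    = refl
∑-parity-toℕ (suc (suc n)) = trans (cong _⁻¹ (∑-parity-toℕ n)) (sym (+-homo-+ 1 ⌊ n /2⌋))

-- left j and right j stand for the pure length j + 1.
data EdgeType (ℓ : ℕ) : Set where
  left right : Fin ℓ → EdgeType ℓ
  mixed      : Fin (2 * ℓ) → EdgeType ℓ

HasType : ∀ {ℓ} → EdgeType ℓ → Vtx ℓ → Vtx ℓ → Set
HasType (left j)  = LeftLen (suc (toℕ j))
HasType (right j) = RightLen (suc (toℕ j))
HasType (mixed d) = MixedDiff (toℕ d)

typeParity : ∀ {ℓ} → EdgeType ℓ → Parity
typeParity (left j)  = parity (suc (toℕ j))
typeParity (right j) = parity (suc (toℕ j))
typeParity (mixed d) = parity (toℕ d)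

vertexParity : ∀ {ℓ} → Vtx ℓ → Parity
vertexParity (x i) = parity (toℕ i)
vertexParity (y i) = parity (toℕ i)

HasType-sym : ∀ {ℓ} (c : EdgeType ℓ) {u v} → HasType c u v → HasType c v u
HasType-sym (left _)  {x _} {x _} = Sum.swap
HasType-sym (right _) {y _} {y _} = Sum.swap
HasType-sym (mixed _) {x _} {y _} = id
HasType-sym (mixed _) {y _} {x _} = id

HasType-unique : ∀ {ℓ} {c c′ : EdgeType ℓ} {u v} → HasType c u v → HasType c′ u v → c ≡ c′
HasType-unique {c = left j}  {left j′}  {x _} {x _} p q =
  cong left (toℕ-injective (cong pred (pureLength-unique (s≤s z≤n) (toℕ<n j) (s≤s z≤n) (toℕ<n j′) p q)))
HasType-unique {c = right j} {right j′} {y _} {y _} p q =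
  cong right (toℕ-injective (cong pred (pureLength-unique (s≤s z≤n) (toℕ<n j) (s≤s z≤n) (toℕ<n j′) p q)))
HasType-unique {c = mixed d} {mixed d′} {x _} {y _} p q =
  cong mixed (toℕ-injective (AddMod-unique (toℕ<n d) (toℕ<n d′) p q))
HasType-unique {c = mixed d} {mixed d′} {y _} {x _} p q =
  cong mixed (toℕ-injective (AddMod-unique (toℕ<n d) (toℕ<n d′) p q))
HasType-unique {c = left _}  {right _} {x _} {x _} _ ()
HasType-unique {c = left _}  {mixed _} {x _} {x _} _ ()
HasType-unique {c = right _} {left _}  {y _} {y _} _ ()
HasType-unique {c = right _} {mixed _} {y _} {y _} _ ()
HasType-unique {c = mixed _} {left _}  {x _} {y _} _ ()
HasType-unique {c = mixed _} {right _} {x _} {y _} _ ()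
HasType-unique {c = mixed _} {left _}  {y _} {x _} _ ()
HasType-unique {c = mixed _} {right _} {y _} {x _} _ ()
HasType-unique {c = left _}  {u = x _} {y _} () _
HasType-unique {c = left _}  {u = y _} () _
HasType-unique {c = right _} {u = y _} {x _} () _
HasType-unique {c = right _} {u = x _} () _
HasType-unique {c = mixed _} {u = x _} {x _} () _
HasType-unique {c = mixed _} {u = y _} {y _} () _

HasType-parity : ∀ {ℓ} (c : EdgeType ℓ) {u v} → HasType c u v →
                 vertexParity u ℙ.+ vertexParity v ≡ typeParity c
HasType-parity {ℓ} (left _)  {x _} {x _} p = pureLength-parity {ℓ} p
HasType-parity {ℓ} (right _) {y _} {y _} p = pureLength-parity {ℓ} p
HasType-parity {ℓ} (mixed d) {x i} {y j} m = AddMod-parity {i = toℕ i} {toℕ d} (parity-2*n ℓ) m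
HasType-parity {ℓ} (mixed d) {y j} {x i} m =
  trans (ℙₚ.+-comm (parity (toℕ j)) _) (AddMod-parity {i = toℕ i} {toℕ d} (parity-2*n ℓ) m)

Vtx↔⊎ : ∀ {ℓ} → Vtx ℓ ↔ (Fin (2 * ℓ) ⊎ Fin (2 * ℓ))
Vtx↔⊎ = mk↔ₛ′ (λ { (x i) → inj₁ i ; (y i) → inj₂ i }) [ x , y ]′
  (λ { (inj₁ _) → refl ; (inj₂ _) → refl }) (λ { (x _) → refl ; (y _) → refl })

EdgeType↔⊎ : ∀ {ℓ} → EdgeType ℓ ↔ ((Fin ℓ ⊎ Fin ℓ) ⊎ Fin (2 * ℓ))
EdgeType↔⊎ = mk↔ₛ′ (λ { (left j) → inj₁ (inj₁ j) ; (right j) → inj₁ (inj₂ j) ; (mixed d) → inj₂ d })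
  [ [ left , right ]′ , mixed ]′
  (λ { (inj₁ (inj₁ _)) → refl ; (inj₁ (inj₂ _)) → refl ; (inj₂ _) → refl })
  (λ { (left _) → refl ; (right _) → refl ; (mixed _) → refl })

enumVtx : ∀ ℓ → Vtx ℓ ↔ Fin (2 * ℓ + 2 * ℓ)
enumVtx _ = ↔-trans Vtx↔⊎ (↔-refl ⊎ₑ ↔-refl)

enumEdgeType : ∀ ℓ → EdgeType ℓ ↔ Fin ((ℓ + ℓ) + 2 * ℓ)
enumEdgeType _ = ↔-trans EdgeType↔⊎ ((↔-refl ⊎ₑ ↔-refl) ⊎ₑ ↔-refl)

∑-typeParity : ∀ ℓ → ∑ (enumEdgeType ℓ) typeParity ≡ parity ℓ
∑-typeParity ℓ = begin
  ∑ (enumEdgeType ℓ) typeParity        ≡⟨ ∑-⊎ pureₑ ↔-refl f ⟩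
  ∑ pureₑ (f ∘ inj₁) ℙ.+ mixedSum      ≡⟨ cong (ℙ._+ mixedSum) (∑-⊎ ↔-refl ↔-refl (f ∘ inj₁)) ⟩
  (pureSum ℙ.+ pureSum) ℙ.+ mixedSum   ≡⟨ cong₂ ℙ._+_ (p+p≡0ℙ pureSum) (∑-parity-toℕ (2 * ℓ)) ⟩
  parity ⌊ 2 * ℓ /2⌋                   ≡⟨ cong (parity ∘ ⌊_/2⌋) (2*n≡n+n ℓ) ⟩
  parity ⌊ ℓ + ℓ /2⌋                   ≡⟨ cong parity (n≡⌊n+n/2⌋ ℓ) ⟨
  parity ℓ                             ∎
  where
  open ≡-Reasoning
  pureₑ : (Fin ℓ ⊎ Fin ℓ) ↔ Fin (ℓ + ℓ)
  pureₑ = ↔-refl ⊎ₑ ↔-refl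
  f : (Fin ℓ ⊎ Fin ℓ) ⊎ Fin (2 * ℓ) → Parity
  f = typeParity ∘ Inverse.from EdgeType↔⊎
  pureSum mixedSum : Parity
  pureSum  = sum {ℓ} (parity ∘ suc ∘ toℕ)
  mixedSum = sum {2 * ℓ} (parity ∘ toℕ)

EdgeOfType : ∀ {ℓ} → OneFactor ℓ → OneFactor ℓ → EdgeType ℓ → Set
EdgeOfType F₁ F₂ c = ∃₂ λ u v → InUnion F₁ F₂ u v × HasType c u v

ExactlyOneEdge⇒∃ : ∀ {ℓ} {P : Vtx ℓ → Vtx ℓ → Set} → ExactlyOneEdge P → ∃₂ P
ExactlyOneEdge⇒∃ (u , v , p , _) = u , v , p

CondI⇒edgeOfType : ∀ {ℓ} {F₁ F₂ : OneFactor ℓ} → CondI F₁ F₂ → ∀ c → EdgeOfType F₁ F₂ c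
CondI⇒edgeOfType (pure , _)      (left j)  = ExactlyOneEdge⇒∃ (proj₁ (pure _ (s≤s z≤n) (toℕ<n j)))
CondI⇒edgeOfType (pure , _)      (right j) = ExactlyOneEdge⇒∃ (proj₂ (pure _ (s≤s z≤n) (toℕ<n j)))
CondI⇒edgeOfType (_ , mixedEdge) (mixed d) = ExactlyOneEdge⇒∃ (mixedEdge d)

module Darts {ℓ} (F₁ F₂ : OneFactor ℓ) (edge : ∀ c → EdgeOfType F₁ F₂ c) where

  factor : Bool → OneFactor ℓ
  factor false = F₁
  factor true  = F₂

  endpoint : EdgeType ℓ → Bool → Vtx ℓ
  endpoint c false = proj₁ (edge c)
  endpoint c true  = proj₁ (proj₂ (edge c))

  edge-in-union : ∀ c → InUnion F₁ F₂ (endpoint c false) (endpoint c true)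
  edge-in-union c = proj₁ (proj₂ (proj₂ (edge c)))

  edge-type : ∀ c → HasType c (endpoint c false) (endpoint c true)
  edge-type c = proj₂ (proj₂ (proj₂ (edge c)))

  host : EdgeType ℓ → Bool
  host c with edge-in-union c
  ... | inj₁ _ = false
  ... | inj₂ _ = true

  host-contains : ∀ c → InF (factor (host c)) (endpoint c false) (endpoint c true)
  host-contains c with edge-in-union c
  ... | inj₁ e = e
  ... | inj₂ e = e

  partner-endpoint : ∀ c o → partner (factor (host c)) (endpoint c o) ≡ endpoint c (not o)
  partner-endpoint c false = host-contains c
  partner-endpoint c true  =
    trans (cong (partner (factor (host c))) (sym (host-contains c))) (involutive (factor (host c)) _)

  endpoints-distinct : ∀ c → endpoint c false ≢ endpoint c true
  endpoints-distinct c e = noFixpoint (factor (host c)) _ (trans (host-contains c) (sym e))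

  endpoint-injective : ∀ c {o o′} → endpoint c o ≡ endpoint c o′ → o ≡ o′
  endpoint-injective c {false} {false} _ = refl
  endpoint-injective c {true}  {true}  _ = refl
  endpoint-injective c {false} {true}  e = contradiction e (endpoints-distinct c)
  endpoint-injective c {true}  {false} e = contradiction (sym e) (endpoints-distinct c)

  endpoints-type : ∀ c o → HasType c (endpoint c o) (endpoint c (not o))
  endpoints-type c false = edge-type c
  endpoints-type c true  = HasType-sym c (edge-type c)

  dart : EdgeType ℓ × Bool → Vtx ℓ × Bool
  dart (c , o) = endpoint c o , host c

  same-dart⇒same-type : ∀ {c c′ o o′} → dart (c , o) ≡ dart (c′ , o′) → c ≡ c′
  same-dart⇒same-type {c} {c′} {o} {o′} eq =
    HasType-unique (endpoints-type c o) (subst₂ (HasType c′) (sym u≡u′) (sym v≡v′) (endpoints-type c′ o′))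
    where
    open ≡-Reasoning
    u≡u′ : endpoint c o ≡ endpoint c′ o′
    u≡u′ = cong proj₁ eq
    v≡v′ : endpoint c (not o) ≡ endpoint c′ (not o′)
    v≡v′ = begin
      endpoint c (not o)                           ≡⟨ partner-endpoint c o ⟨
      partner (factor (host c)) (endpoint c o)     ≡⟨ cong₂ (partner ∘ factor) (cong proj₂ eq) u≡u′ ⟩
      partner (factor (host c′)) (endpoint c′ o′)  ≡⟨ partner-endpoint c′ o′ ⟩
      endpoint c′ (not o′)                         ∎

  dart-injective : Injective _≡_ _≡_ dart
  dart-injective {c , o} {c′ , o′} eq with refl ← same-dart⇒same-type {c} {c′} {o} {o′} eq =
    cong (c ,_) (endpoint-injective c (cong proj₁ eq))

  parity-ℓ≡0ℙ : parity ℓ ≡ 0ℙ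
  parity-ℓ≡0ℙ = begin
    parity ℓ
      ≡⟨ ∑-typeParity ℓ ⟨
    ∑ types typeParity
      ≡⟨ ∑-cong types (λ c → HasType-parity c (edge-type c)) ⟨
    ∑ types (λ c → vertexParity (endpoint c false) ℙ.+ vertexParity (endpoint c true))
      ≡⟨ ∑-×Bool types (vertexParity ∘ proj₁ ∘ dart) ⟨
    ∑ (×Boolₑ types) (vertexParity ∘ proj₁ ∘ dart)
      ≡⟨ ∑-injection (×Boolₑ types) (×Boolₑ vertices) sizes dart-injective (vertexParity ∘ proj₁) ⟩
    ∑ (×Boolₑ vertices) (vertexParity ∘ proj₁)
      ≡⟨ ∑-×Bool vertices (vertexParity ∘ proj₁) ⟩
    ∑ vertices (λ u → vertexParity u ℙ.+ vertexParity u)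
      ≡⟨ ∑-cong vertices (p+p≡0ℙ ∘ vertexParity) ⟩
    sum {2 * ℓ + 2 * ℓ} (λ _ → 0ℙ)
      ≡⟨ sum-replicate-zero (2 * ℓ + 2 * ℓ) ⟩
    0ℙ
      ∎
    where
    open ≡-Reasoning
    types = enumEdgeType ℓ
    vertices = enumVtx ℓ
    sizes : ((ℓ + ℓ) + 2 * ℓ) + ((ℓ + ℓ) + 2 * ℓ) ≡ (2 * ℓ + 2 * ℓ) + (2 * ℓ + 2 * ℓ)
    sizes = cong (λ m → (m + 2 * ℓ) + (m + 2 * ℓ)) (sym (2*n≡n+n ℓ))

parity≡0ℙ⇒⌊n/2⌋+⌊n/2⌋≡n : ∀ n → parity n ≡ 0ℙ → ⌊ n /2⌋ + ⌊ n /2⌋ ≡ n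
parity≡0ℙ⇒⌊n/2⌋+⌊n/2⌋≡n zero          _ = refl
parity≡0ℙ⇒⌊n/2⌋+⌊n/2⌋≡n (suc (suc n)) e =
  cong suc (trans (+-suc ⌊ n /2⌋ ⌊ n /2⌋) (cong suc (parity≡0ℙ⇒⌊n/2⌋+⌊n/2⌋≡n n e)))

[4n+1]%8≡5⇒parity≡1ℙ : ∀ n → (4 * n + 1) % 8 ≡ 5 → parity n ≡ 1ℙ
[4n+1]%8≡5⇒parity≡1ℙ n h with parity n in n-even
... | 1ℙ = refl
... | 0ℙ = contradiction (begin
  5                      ≡⟨ h ⟨
  (4 * n + 1) % 8        ≡⟨ cong (λ m → (4 * m + 1) % 8) (parity≡0ℙ⇒⌊n/2⌋+⌊n/2⌋≡n n n-even) ⟨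
  (4 * (k + k) + 1) % 8  ≡⟨ cong (_% 8) (rearrange k) ⟩
  (1 + k * 8) % 8        ≡⟨ [m+kn]%n≡m%n 1 k 8 ⟩
  1                      ∎) λ ()
  where
  open ≡-Reasoning
  k = ⌊ n /2⌋
  rearrange : ∀ k → 4 * (k + k) + 1 ≡ 1 + k * 8
  rearrange = solve-∀

lemma3p10 : (ℓ : ℕ) → (4 * ℓ + 1) % 8 ≡ 5 →
    ¬ (Σ (OneFactor ℓ) λ F₁ → Σ (OneFactor ℓ) λ F₂ → CondI F₁ F₂ × CondII F₁ F₂)
lemma3p10 ℓ h (F₁ , F₂ , condI , _) = contradiction (trans (sym ℓ-odd) ℓ-even) λ ()
  where
  ℓ-odd  = [4n+1]%8≡5⇒parity≡1ℙ ℓ h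
  ℓ-even = Darts.parity-ℓ≡0ℙ F₁ F₂ (CondI⇒edgeOfType {F₁ = F₁} {F₂} condI)
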